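{- Let $d$ be an integer. Each coefficient of the polynomial \[ G_{d}(j,n)= \sum_{k=0}^{|d|} f_k(j) \left( \prod_{r=0}^{k-1} (d^2-r^2) \right) \left( \prod_{r=k}^{|d|-1} (n+d^2-r^2) \right)\in\mathbb{Q}[j,n], \] where $f_0(j)=1$ and $f_k(j)= (-1)^k \frac{j^{\downarrow k} \, (2j-1)^{\uparrow \uparrow k}}{k! \, (2k-1)!!}$ for $k\ge1$, is an integer.
   Context: $j^{\downarrow k}=j(j-1)\cdots(j-k+1)$; $a^{\uparrow\uparrow k}=\prod_{r=0}^{k-1}(a+2r)$; $(2k-1)!!=1\cdot3\cdots(2k-1)$. Empty products equal $1$. Here $j,n$ are indeterminates. -}

module Defs where

open import Data.Nat as ℕ using (ℕ; zero; suc; NonZero; _!)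
open import Data.Nat.Properties as ℕP using (m*n≢0; _!≢0)
open import Data.Integer as ℤ using (ℤ; +_; ∣_∣)
open import Data.Rational as ℚ using (ℚ; 0ℚ; 1ℚ; _/_)
open import Data.List using (List; []; _∷_)

ℤ→ℚ : ℤ → ℚ
ℤ→ℚ z = z / 1

-- Polynomials in Q[j,n] as coefficient lists (lowest degree first).
-- Poly1 : polynomials in n;  Poly2 : polynomials in j with Poly1 coefficients.

Poly1 : Set
Poly1 = List ℚ

Poly2 : Set
Poly2 = List Poly1

add1 : Poly1 → Poly1 → Poly1
add1 [] q = q
add1 p [] = p
add1 (a ∷ p) (b ∷ q) = (a ℚ.+ b) ∷ add1 p q

scale1 : ℚ → Poly1 → Poly1
scale1 c [] = []
scale1 c (a ∷ p) = (c ℚ.* a) ∷ scale1 c p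

mul1 : Poly1 → Poly1 → Poly1
mul1 [] q = []
mul1 (a ∷ p) q = add1 (scale1 a q) (0ℚ ∷ mul1 p q)

add2 : Poly2 → Poly2 → Poly2
add2 [] q = q
add2 p [] = p
add2 (a ∷ p) (b ∷ q) = add1 a b ∷ add2 p q

scale2 : Poly1 → Poly2 → Poly2
scale2 c [] = []
scale2 c (a ∷ p) = mul1 c a ∷ scale2 c p

mul2 : Poly2 → Poly2 → Poly2
mul2 [] q = []
mul2 (a ∷ p) q = add2 (scale2 a q) ([] ∷ mul2 p q)

coeff1 : Poly1 → ℕ → ℚ
coeff1 [] _ = 0ℚ
coeff1 (c ∷ p) zero = c
coeff1 (c ∷ p) (suc b) = coeff1 p b

coeff : Poly2 → ℕ → ℕ → ℚ
coeff [] _ _ = 0ℚ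
coeff (c ∷ p) zero b = coeff1 c b
coeff (c ∷ p) (suc a) b = coeff p a b

const2 : ℚ → Poly2
const2 c = (c ∷ []) ∷ []

one2 : Poly2
one2 = const2 1ℚ

varJ : Poly2
varJ = [] ∷ (1ℚ ∷ []) ∷ []

varN : Poly2
varN = (0ℚ ∷ 1ℚ ∷ []) ∷ []

prod2 : ℕ → (ℕ → Poly2) → Poly2
prod2 zero f = one2
prod2 (suc k) f = mul2 (prod2 k f) (f k)

-- ∑_{k=0}^{m} f k   (inclusive upper bound)
sum2 : ℕ → (ℕ → Poly2) → Poly2
sum2 zero f = f zero
sum2 (suc m) f = add2 (sum2 m f) (f (suc m))

prodFrom2 : ℕ → ℕ → (ℕ → Poly2) → Poly2
prodFrom2 k m f = prod2 (m ℕ.∸ k) (λ i → f (k ℕ.+ i))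

prodℚ : ℕ → (ℕ → ℚ) → ℚ
prodℚ zero f = 1ℚ
prodℚ (suc k) f = prodℚ k f ℚ.* f k

-- (2k-1)!! = 1·3·…·(2k-1), with (-1)!! = 1
oddFact : ℕ → ℕ
oddFact zero = 1
oddFact (suc k) = oddFact k ℕ.* suc (2 ℕ.* k)

oddFact≢0 : ∀ k → NonZero (oddFact k)
oddFact≢0 zero = _
oddFact≢0 (suc k) = m*n≢0 (oddFact k) (suc (2 ℕ.* k)) {{oddFact≢0 k}}

denom≢0 : ∀ k → NonZero (k ! ℕ.* oddFact k)
denom≢0 k = m*n≢0 (k !) (oddFact k) {{k !≢0}} {{oddFact≢0 k}}

fallingJ : ℕ → Poly2
fallingJ k = prod2 k (λ r → add2 varJ (const2 (ℚ.- ℤ→ℚ (+ r))))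

-- (2j-1)^{↑↑k} = ∏_{r<k} (2j-1+2r)
doubleRisingJ : ℕ → Poly2
doubleRisingJ k =
  prod2 k (λ r → add2 (mul2 (const2 (ℤ→ℚ (+ 2))) varJ)
                      (const2 (ℤ→ℚ (+ (2 ℕ.* r)) ℚ.- 1ℚ)))

signQ : ℕ → ℚ
signQ zero = 1ℚ
signQ (suc k) = ℚ.- signQ k

fcoef : ℕ → Poly2
fcoef k = mul2 (const2 (signQ k ℚ.* (+ 1 / (k ! ℕ.* oddFact k)) {{denom≢0 k}}))
               (mul2 (fallingJ k) (doubleRisingJ k))

sqDiff : ℤ → ℕ → ℚ
sqDiff d r = ℤ→ℚ (d ℤ.* d ℤ.- + (r ℕ.* r))

G : ℤ → Poly2
G d = sum2 ∣ d ∣ (λ k →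
        mul2 (fcoef k)
          (mul2 (const2 (prodℚ k (sqDiff d)))
                (prodFrom2 k ∣ d ∣ (λ r → add2 varN (const2 (sqDiff d r))))))

-- With e = |d|, the factor ∏_{r<k} (d² − r²) equals e·(e+k−1)^{↓(2k−1)}, so twice it is
-- (e+k)^{↓2k} + (e+k−1)^{↓2k}. Both falling factorials are divisible by (2k)! = 2^k k! (2k−1)!!,
-- hence k! (2k−1)!! divides ∏_{r<k} (d² − r²) for k ≤ e. The rational constant of f_k times this
-- product is therefore an integer, and every other factor of the k-th summand is a polynomial with
-- integer coefficients.

module Submission where

open import Defs
open import Data.Nat
  using (ℕ; zero; suc; _+_; _*_; _∸_; _^_; _≤_; _<_; _!; NonZero; z≤n; s≤s⁻¹)
open import Data.Nat.Properties
open import Data.Nat.Combinatorics.Base using (_P′_)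
open import Data.Nat.Combinatorics.Specification using (k!∣nP′k; nP′k≡n[n∸1P′k∸1])
open import Data.Nat.Coprimality using (1-coprimeTo)
open import Data.Nat.Divisibility
  using (_∣_; divides; _∣0; ∣-refl; ∣m∣n⇒∣m+n; *-cancelˡ-∣; m*n∣⇒m∣; module ∣-Reasoning)
open import Data.Nat.Solver using (module +-*-Solver)
open import Data.Integer as ℤ using (ℤ; +_; -[1+_]; ∣_∣)
import Data.Integer.Properties as ℤP
open import Data.Rational as ℚ using (ℚ; 0ℚ; 1ℚ; 1/_)
import Data.Rational.Properties as ℚP
open import Data.Rational.Literals using (fromℤ)
open import Algebra.Bundles using (CommutativeMonoid)
import Algebra.Properties.CommutativeSemigroup as CommSemigroupProperties
open import Data.List.Relation.Unary.All as All using (All; []; _∷_)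
open import Data.Product using (∃; _,_)
open import Data.Sum using (inj₁; inj₂)
open import Relation.Nullary using (yes; no)
open import Relation.Binary.PropositionalEquality

open +-*-Solver
open CommSemigroupProperties (CommutativeMonoid.commutativeSemigroup ℚP.*-1-commutativeMonoid)
  using (interchange)

prodSqDiff : ℕ → ℕ → ℕ
prodSqDiff e zero    = 1
prodSqDiff e (suc k) = prodSqDiff e k * (e * e ∸ k * k)

[m∸n]*[m+n]≡m*m∸n*n : ∀ m n → (m ∸ n) * (m + n) ≡ m * m ∸ n * n
[m∸n]*[m+n]≡m*m∸n*n m n = begin
  (m ∸ n) * (m + n)                 ≡⟨ *-distribʳ-∸ (m + n) m n ⟩
  m * (m + n) ∸ n * (m + n)         ≡⟨ cong₂ _∸_ (*-distribˡ-+ m m n) (*-distribˡ-+ n m n) ⟩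
  (m * m + m * n) ∸ (n * m + n * n) ≡⟨ cong₂ (λ x y → x ∸ (y + n * n)) (+-comm (m * m) (m * n)) (*-comm n m) ⟩
  (m * n + m * m) ∸ (m * n + n * n) ≡⟨ [m+n]∸[m+o]≡n∸o (m * n) (m * m) (n * n) ⟩
  m * m ∸ n * n                     ∎
  where open ≡-Reasoning

m+n∸[1+2n]≡m∸[1+n] : ∀ m n → m + n ∸ suc (n + n) ≡ m ∸ suc n
m+n∸[1+2n]≡m∸[1+n] m n = begin
  m + n ∸ suc (n + n) ≡⟨ cong₂ _∸_ (+-comm n m) (+-suc n n) ⟨
  n + m ∸ (n + suc n) ≡⟨ [m+n]∸[m+o]≡n∸o n m (suc n) ⟩
  m ∸ suc n           ∎
  where open ≡-Reasoning

[m+1+n]P′[2+2n]≡[m+1+n]*[m+n]P′[1+2n] : ∀ m n →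
  (m + suc n) P′ suc (suc (n + n)) ≡ (m + suc n) * ((m + n) P′ suc (n + n))
[m+1+n]P′[2+2n]≡[m+1+n]*[m+n]P′[1+2n] m n =
  subst (λ k → k P′ suc (suc (n + n)) ≡ k * ((m + n) P′ suc (n + n)))
        (sym (+-suc m n)) (nP′k≡n[n∸1P′k∸1] (suc (m + n)) (suc (suc (n + n))))

prodSqDiff≡e*P′ : ∀ e m → prodSqDiff e (suc m) ≡ e * ((e + m) P′ suc (m + m))
prodSqDiff≡e*P′ e zero = solve 1 (λ e → con 1 :* (e :* e) := e :* ((e :+ con 0) :* con 1)) refl e
prodSqDiff≡e*P′ e (suc m) = begin
  prodSqDiff e (suc m) * (e * e ∸ suc m * suc m)
    ≡⟨ cong₂ _*_ (sym (prodSqDiff≡e*P′ e m)) ([m∸n]*[m+n]≡m*m∸n*n e (suc m)) ⟨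
  e * F * ((e ∸ suc m) * (e + suc m))
    ≡⟨ solve 4 (λ e F a b → e :* F :* (a :* b) := e :* (a :* (b :* F))) refl e F (e ∸ suc m) (e + suc m) ⟩
  e * ((e ∸ suc m) * ((e + suc m) * F))
    ≡⟨ cong₂ (λ x y → e * (x * y)) lower upper ⟩
  e * ((e + suc m) P′ suc (suc m + suc m)) ∎
  where
  open ≡-Reasoning
  F : ℕ
  F = (e + m) P′ suc (m + m)
  lower : e ∸ suc m ≡ e + suc m ∸ suc (m + suc m)
  lower = trans (sym (m+n∸[1+2n]≡m∸[1+n] e m)) (cong₂ _∸_ (sym (+-suc e m)) (cong suc (sym (+-suc m m))))
  upper : (e + suc m) * F ≡ (e + suc m) P′ suc (m + suc m)
  upper = trans (sym ([m+1+n]P′[2+2n]≡[m+1+n]*[m+n]P′[1+2n] e m)) (cong (λ k → (e + suc m) P′ suc k) (sym (+-suc m m)))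

2*prodSqDiff≡P′+P′ : ∀ {e m} → suc m ≤ e →
  2 * prodSqDiff e (suc m) ≡ (e + suc m) P′ suc (suc (m + m)) + (e + m) P′ suc (suc (m + m))
2*prodSqDiff≡P′+P′ {e} {m} m<e = begin
  2 * prodSqDiff e (suc m)                        ≡⟨ cong (2 *_) (prodSqDiff≡e*P′ e m) ⟩
  2 * (e * F)                                     ≡⟨ solve 2 (λ e F → con 2 :* (e :* F) := (e :+ e) :* F) refl e F ⟩
  (e + e) * F                                     ≡⟨ cong (λ x → (e + x) * F) (m+[n∸m]≡n m<e) ⟨
  (e + (suc m + (e ∸ suc m))) * F                 ≡⟨ cong (_* F) (+-assoc e (suc m) (e ∸ suc m)) ⟨
  (e + suc m + (e ∸ suc m)) * F                   ≡⟨ *-distribʳ-+ F (e + suc m) (e ∸ suc m) ⟩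
  (e + suc m) * F + (e ∸ suc m) * F               ≡⟨ cong₂ _+_ ([m+1+n]P′[2+2n]≡[m+1+n]*[m+n]P′[1+2n] e m) (cong (_* F) (m+n∸[1+2n]≡m∸[1+n] e m)) ⟨
  (e + suc m) P′ suc (suc (m + m)) + (e + m) P′ suc (suc (m + m)) ∎
  where
  open ≡-Reasoning
  F : ℕ
  F = (e + m) P′ suc (m + m)

[k!*oddFact-k]*2^k≡[2k]! : ∀ k → (k ! * oddFact k) * 2 ^ k ≡ (k + k) !
[k!*oddFact-k]*2^k≡[2k]! zero = refl
[k!*oddFact-k]*2^k≡[2k]! (suc k) = begin
  (suc k ! * oddFact (suc k)) * 2 ^ suc k
    ≡⟨ solve 4 (λ k f o p → ((con 1 :+ k) :* f :* (o :* (con 1 :+ con 2 :* k))) :* (con 2 :* p)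
                          := (con 2 :+ k :+ k) :* ((con 1 :+ k :+ k) :* (f :* o :* p))) refl k (k !) (oddFact k) (2 ^ k) ⟩
  suc (suc (k + k)) * (suc (k + k) * ((k ! * oddFact k) * 2 ^ k))
    ≡⟨ cong (λ x → suc (suc (k + k)) * (suc (k + k) * x)) ([k!*oddFact-k]*2^k≡[2k]! k) ⟩
  suc (suc (k + k)) !
    ≡⟨ cong (λ x → suc x !) (+-suc k k) ⟨
  (suc k + suc k) ! ∎
  where open ≡-Reasoning

n<k⇒nP′k≡0 : ∀ {n k} → n < k → n P′ k ≡ 0
n<k⇒nP′k≡0 {n} {suc k} n<1+k with m≤n⇒m<n∨m≡n (s≤s⁻¹ n<1+k)
... | inj₁ n<k  = trans (cong ((n ∸ k) *_) (n<k⇒nP′k≡0 n<k)) (*-zeroʳ (n ∸ k))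
... | inj₂ refl = cong (_* (n P′ n)) (n∸n≡0 n)

k!∣nP′k′ : ∀ n k → k ! ∣ n P′ k
k!∣nP′k′ n k with k ≤? n
... | yes k≤n = k!∣nP′k k≤n
... | no  k≰n = subst (k ! ∣_) (sym (n<k⇒nP′k≡0 (≰⇒> k≰n))) ((k !) ∣0)

k!*oddFact∣prodSqDiff : ∀ {e k} → k ≤ e → k ! * oddFact k ∣ prodSqDiff e k
k!*oddFact∣prodSqDiff {e} {zero}  _   = ∣-refl
k!*oddFact∣prodSqDiff {e} {suc m} m<e = m*n∣⇒m∣ D (2 ^ m) (*-cancelˡ-∣ 2 (begin
  2 * (D * 2 ^ m)           ≡⟨ solve 2 (λ D p → con 2 :* (D :* p) := D :* (con 2 :* p)) refl D (2 ^ m) ⟩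
  D * 2 ^ suc m             ≡⟨ [k!*oddFact-k]*2^k≡[2k]! (suc m) ⟩
  (suc m + suc m) !         ≡⟨ cong (λ x → suc x !) (+-suc m m) ⟩
  suc (suc (m + m)) !       ∣⟨ ∣m∣n⇒∣m+n (k!∣nP′k′ (e + suc m) 2m+2) (k!∣nP′k′ (e + m) 2m+2) ⟩
  (e + suc m) P′ suc (suc (m + m)) + (e + m) P′ suc (suc (m + m)) ≡⟨ 2*prodSqDiff≡P′+P′ m<e ⟨
  2 * prodSqDiff e (suc m)  ∎))
  where
  open ∣-Reasoning
  D 2m+2 : ℕ
  D = suc m ! * oddFact (suc m)
  2m+2 = suc (suc (m + m))

ℤ→ℚ≡fromℤ : ∀ z → ℤ→ℚ z ≡ fromℤ z
ℤ→ℚ≡fromℤ z = ℚP.↥p/↧p≡p (fromℤ z)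

ℤ→ℚ-+ : ∀ a b → ℤ→ℚ (a ℤ.+ b) ≡ ℤ→ℚ a ℚ.+ ℤ→ℚ b
ℤ→ℚ-+ a b = begin
  ℤ→ℚ (a ℤ.+ b)                 ≡⟨ cong₂ (λ x y → ℤ→ℚ (x ℤ.+ y)) (ℤP.*-identityʳ a) (ℤP.*-identityʳ b) ⟨
  ℤ→ℚ (a ℤ.* + 1 ℤ.+ b ℤ.* + 1) ≡⟨⟩
  fromℤ a ℚ.+ fromℤ b           ≡⟨ cong₂ ℚ._+_ (ℤ→ℚ≡fromℤ a) (ℤ→ℚ≡fromℤ b) ⟨
  ℤ→ℚ a ℚ.+ ℤ→ℚ b               ∎
  where open ≡-Reasoning

ℤ→ℚ-* : ∀ a b → ℤ→ℚ (a ℤ.* b) ≡ ℤ→ℚ a ℚ.* ℤ→ℚ b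
ℤ→ℚ-* a b = sym (cong₂ ℚ._*_ (ℤ→ℚ≡fromℤ a) (ℤ→ℚ≡fromℤ b))

fromℤ-neg : ∀ z → fromℤ (ℤ.- z) ≡ ℚ.- fromℤ z
fromℤ-neg (+ zero)  = refl
fromℤ-neg (+ suc n) = refl
fromℤ-neg -[1+ n ]  = refl

ℤ→ℚ-neg : ∀ z → ℤ→ℚ (ℤ.- z) ≡ ℚ.- ℤ→ℚ z
ℤ→ℚ-neg z = begin
  ℤ→ℚ (ℤ.- z)     ≡⟨ ℤ→ℚ≡fromℤ (ℤ.- z) ⟩
  fromℤ (ℤ.- z)   ≡⟨ fromℤ-neg z ⟩
  ℚ.- fromℤ z     ≡⟨ cong ℚ.-_ (ℤ→ℚ≡fromℤ z) ⟨
  ℚ.- ℤ→ℚ z       ∎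
  where open ≡-Reasoning

record Multiple (q a : ℚ) : Set where
  constructor _,_
  field
    quotient : ℤ
    equation : a ≡ q ℚ.* ℤ→ℚ quotient

Integer : ℚ → Set
Integer = Multiple 1ℚ

integer : ∀ z → Integer (ℤ→ℚ z)
integer z = z , sym (ℚP.*-identityˡ (ℤ→ℚ z))

multiple-0 : ∀ {q} → Multiple q 0ℚ
multiple-0 {q} = + 0 , sym (ℚP.*-zeroʳ q)

multiple-refl : ∀ {q} → Multiple q q
multiple-refl {q} = + 1 , sym (ℚP.*-identityʳ q)

multiple-+ : ∀ {q a b} → Multiple q a → Multiple q b → Multiple q (a ℚ.+ b)
multiple-+ {q} (z , refl) (w , refl) =
  z ℤ.+ w , trans (sym (ℚP.*-distribˡ-+ q (ℤ→ℚ z) (ℤ→ℚ w))) (cong (q ℚ.*_) (sym (ℤ→ℚ-+ z w)))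

multiple-neg : ∀ {q a} → Multiple q a → Multiple q (ℚ.- a)
multiple-neg {q} (z , refl) =
  ℤ.- z , trans (ℚP.neg-distribʳ-* q (ℤ→ℚ z)) (cong (q ℚ.*_) (sym (ℤ→ℚ-neg z)))

multiple-* : ∀ {p r a b} → Multiple p a → Multiple r b → Multiple (p ℚ.* r) (a ℚ.* b)
multiple-* {p} {r} (z , refl) (w , refl) =
  z ℤ.* w , trans (interchange p (ℤ→ℚ z) r (ℤ→ℚ w)) (cong (p ℚ.* r ℚ.*_) (sym (ℤ→ℚ-* z w)))

multiple-trans : ∀ {p q a} → Multiple p q → Multiple q a → Multiple p a
multiple-trans {p} (w , refl) (z , refl) =
  w ℤ.* z , trans (ℚP.*-assoc p (ℤ→ℚ w) (ℤ→ℚ z)) (cong (p ℚ.*_) (sym (ℤ→ℚ-* w z)))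

integer-* : ∀ {a b} → Integer a → Integer b → Integer (a ℚ.* b)
integer-* {a} {b} i j = subst (λ q → Multiple q (a ℚ.* b)) (ℚP.*-identityˡ 1ℚ) (multiple-* i j)

∣⇒integer : ∀ {n m} .{{_ : NonZero n}} → n ∣ m → Integer ((+ 1 ℚ./ n) ℚ.* ℤ→ℚ (+ m))
∣⇒integer {zero} {{()}}
∣⇒integer {suc n-1} (divides q refl) = + q , (begin
  (+ 1 ℚ./ suc n-1) ℚ.* ℤ→ℚ (+ (q * suc n-1)) ≡⟨ cong₂ ℚ._*_ 1/n≡1/N (ℤ→ℚ[q*n]≡Q*N) ⟩
  1/ N ℚ.* (Q ℚ.* N)                          ≡⟨ cong (1/ N ℚ.*_) (ℚP.*-comm Q N) ⟩
  1/ N ℚ.* (N ℚ.* Q)                          ≡⟨ ℚP.*-assoc (1/ N) N Q ⟨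
  (1/ N ℚ.* N) ℚ.* Q                          ≡⟨ cong (ℚ._* Q) (ℚP.*-inverseˡ N) ⟩
  1ℚ ℚ.* Q                                    ∎)
  where
  open ≡-Reasoning
  N Q : ℚ
  N = fromℤ (+ suc n-1)
  Q = ℤ→ℚ (+ q)
  1/n≡1/N : + 1 ℚ./ suc n-1 ≡ 1/ N
  1/n≡1/N = ℚP.normalize-coprime (1-coprimeTo (suc n-1))
  ℤ→ℚ[q*n]≡Q*N : ℤ→ℚ (+ (q * suc n-1)) ≡ Q ℚ.* N
  ℤ→ℚ[q*n]≡Q*N = begin
    ℤ→ℚ (+ (q * suc n-1))        ≡⟨ cong ℤ→ℚ (ℤP.pos-* q (suc n-1)) ⟩
    ℤ→ℚ (+ q ℤ.* + suc n-1)      ≡⟨ ℤ→ℚ-* (+ q) (+ suc n-1) ⟩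
    Q ℚ.* ℤ→ℚ (+ suc n-1)        ≡⟨ cong (Q ℚ.*_) (ℤ→ℚ≡fromℤ (+ suc n-1)) ⟩
    Q ℚ.* N                      ∎

Multiples₁ : ℚ → Poly1 → Set
Multiples₁ q = All (Multiple q)

Multiples₂ : ℚ → Poly2 → Set
Multiples₂ q = All (Multiples₁ q)

Integral₂ : Poly2 → Set
Integral₂ = Multiples₂ 1ℚ

add1-multiples : ∀ {q p p′} → Multiples₁ q p → Multiples₁ q p′ → Multiples₁ q (add1 p p′)
add1-multiples []       hs       = hs
add1-multiples (h ∷ hs) []       = h ∷ hs
add1-multiples (h ∷ hs) (k ∷ ks) = multiple-+ h k ∷ add1-multiples hs ks

scale1-multiples : ∀ {a b c p} → Multiple a c → Multiples₁ b p → Multiples₁ (a ℚ.* b) (scale1 c p)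
scale1-multiples h []       = []
scale1-multiples h (k ∷ ks) = multiple-* h k ∷ scale1-multiples h ks

mul1-multiples : ∀ {a b p p′} → Multiples₁ a p → Multiples₁ b p′ → Multiples₁ (a ℚ.* b) (mul1 p p′)
mul1-multiples []       ks = []
mul1-multiples (h ∷ hs) ks = add1-multiples (scale1-multiples h ks) (multiple-0 ∷ mul1-multiples hs ks)

add2-multiples : ∀ {q p p′} → Multiples₂ q p → Multiples₂ q p′ → Multiples₂ q (add2 p p′)
add2-multiples []       hs       = hs
add2-multiples (h ∷ hs) []       = h ∷ hs
add2-multiples (h ∷ hs) (k ∷ ks) = add1-multiples h k ∷ add2-multiples hs ks

scale2-multiples : ∀ {a b c p} → Multiples₁ a c → Multiples₂ b p → Multiples₂ (a ℚ.* b) (scale2 c p)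
scale2-multiples h []       = []
scale2-multiples h (k ∷ ks) = mul1-multiples h k ∷ scale2-multiples h ks

mul2-multiples : ∀ {a b p p′} → Multiples₂ a p → Multiples₂ b p′ → Multiples₂ (a ℚ.* b) (mul2 p p′)
mul2-multiples []       ks = []
mul2-multiples (h ∷ hs) ks = add2-multiples (scale2-multiples h ks) ([] ∷ mul2-multiples hs ks)

mul2-multiples-integral : ∀ {q p p′} → Multiples₂ q p → Integral₂ p′ → Multiples₂ q (mul2 p p′)
mul2-multiples-integral {q} {p} {p′} hs ks = subst (λ r → Multiples₂ r (mul2 p p′)) (ℚP.*-identityʳ q) (mul2-multiples hs ks)

mul2-integral : ∀ {p p′} → Integral₂ p → Integral₂ p′ → Integral₂ (mul2 p p′)
mul2-integral = mul2-multiples-integral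

multiples₂-trans : ∀ {p q f} → Multiple p q → Multiples₂ q f → Multiples₂ p f
multiples₂-trans h = All.map (All.map (multiple-trans h))

const2-multiples : ∀ {q c} → Multiple q c → Multiples₂ q (const2 c)
const2-multiples h = (h ∷ []) ∷ []

coeff1-multiple : ∀ {q p} → Multiples₁ q p → ∀ b → Multiple q (coeff1 p b)
coeff1-multiple []       b       = multiple-0
coeff1-multiple (h ∷ hs) zero    = h
coeff1-multiple (h ∷ hs) (suc b) = coeff1-multiple hs b

coeff-multiple : ∀ {q p} → Multiples₂ q p → ∀ a b → Multiple q (coeff p a b)
coeff-multiple []       a       b = multiple-0
coeff-multiple (h ∷ hs) zero    b = coeff1-multiple h b
coeff-multiple (h ∷ hs) (suc a) b = coeff-multiple hs a b

varJ-integral : Integral₂ varJ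
varJ-integral = [] ∷ (multiple-refl ∷ []) ∷ []

varN-integral : Integral₂ varN
varN-integral = (multiple-0 ∷ multiple-refl ∷ []) ∷ []

prod2-integral : ∀ k f → (∀ r → Integral₂ (f r)) → Integral₂ (prod2 k f)
prod2-integral zero    f hs = const2-multiples multiple-refl
prod2-integral (suc k) f hs = mul2-integral (prod2-integral k f hs) (hs k)

sum2-integral : ∀ m f → (∀ k → k ≤ m → Integral₂ (f k)) → Integral₂ (sum2 m f)
sum2-integral zero    f hs = hs zero z≤n
sum2-integral (suc m) f hs =
  add2-multiples (sum2-integral m f (λ k k≤m → hs k (m≤n⇒m≤1+n k≤m))) (hs (suc m) ≤-refl)

fallingJ-integral : ∀ k → Integral₂ (fallingJ k)
fallingJ-integral k =
  prod2-integral k _ (λ r → add2-multiples varJ-integral (const2-multiples (multiple-neg (integer (+ r)))))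

doubleRisingJ-integral : ∀ k → Integral₂ (doubleRisingJ k)
doubleRisingJ-integral k = prod2-integral k _ (λ r →
  add2-multiples (mul2-integral (const2-multiples (integer (+ 2))) varJ-integral)
                 (const2-multiples (multiple-+ (integer (+ (2 * r))) (multiple-neg multiple-refl))))

signQ-integer : ∀ k → Integer (signQ k)
signQ-integer zero    = multiple-refl
signQ-integer (suc k) = multiple-neg (signQ-integer k)

i*i≡+∣i∣*∣i∣ : ∀ i → i ℤ.* i ≡ + (∣ i ∣ * ∣ i ∣)
i*i≡+∣i∣*∣i∣ (+ n)    = sym (ℤP.pos-* n n)
i*i≡+∣i∣*∣i∣ -[1+ n ] = refl

sqDiff≡ℤ→ℚ[∣d∣²∸r²] : ∀ d r → r ≤ ∣ d ∣ → sqDiff d r ≡ ℤ→ℚ (+ (∣ d ∣ * ∣ d ∣ ∸ r * r))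
sqDiff≡ℤ→ℚ[∣d∣²∸r²] d r r≤e = cong ℤ→ℚ (begin
  d ℤ.* d ℤ.- + (r * r)            ≡⟨ cong (ℤ._- + (r * r)) (i*i≡+∣i∣*∣i∣ d) ⟩
  + (e * e) ℤ.- + (r * r)          ≡⟨ ℤP.[+m]-[+n]≡m⊖n (e * e) (r * r) ⟩
  (e * e) ℤ.⊖ (r * r)              ≡⟨ ℤP.⊖-≥ (*-mono-≤ r≤e r≤e) ⟩
  + (e * e ∸ r * r)                ∎)
  where
  open ≡-Reasoning
  e : ℕ
  e = ∣ d ∣

prodℚ-sqDiff : ∀ d k → k ≤ ∣ d ∣ → prodℚ k (sqDiff d) ≡ ℤ→ℚ (+ prodSqDiff ∣ d ∣ k)
prodℚ-sqDiff d zero    _   = refl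
prodℚ-sqDiff d (suc k) k<e = begin
  prodℚ k (sqDiff d) ℚ.* sqDiff d k
    ≡⟨ cong₂ ℚ._*_ (prodℚ-sqDiff d k (<⇒≤ k<e)) (sqDiff≡ℤ→ℚ[∣d∣²∸r²] d k (<⇒≤ k<e)) ⟩
  ℤ→ℚ (+ prodSqDiff e k) ℚ.* ℤ→ℚ (+ (e * e ∸ k * k))
    ≡⟨ ℤ→ℚ-* (+ prodSqDiff e k) (+ (e * e ∸ k * k)) ⟨
  ℤ→ℚ (+ prodSqDiff e k ℤ.* + (e * e ∸ k * k))
    ≡⟨ cong ℤ→ℚ (ℤP.pos-* (prodSqDiff e k) (e * e ∸ k * k)) ⟨
  ℤ→ℚ (+ prodSqDiff e (suc k)) ∎
  where
  open ≡-Reasoning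
  e : ℕ
  e = ∣ d ∣

fcoefScalar : ℕ → ℚ
fcoefScalar k = signQ k ℚ.* (+ 1 ℚ./ (k ! * oddFact k)) {{denom≢0 k}}

fcoefScalar*prodℚ-integer : ∀ d k → k ≤ ∣ d ∣ → Integer (fcoefScalar k ℚ.* prodℚ k (sqDiff d))
fcoefScalar*prodℚ-integer d k k≤e =
  subst Integer (trans (sym (ℚP.*-assoc (signQ k) _ _)) (cong (fcoefScalar k ℚ.*_) (sym (prodℚ-sqDiff d k k≤e))))
    (integer-* (signQ-integer k) (∣⇒integer {{denom≢0 k}} (k!*oddFact∣prodSqDiff k≤e)))

summand : ℤ → ℕ → Poly2
summand d k =
  mul2 (fcoef k) (mul2 (const2 (prodℚ k (sqDiff d)))
                       (prodFrom2 k ∣ d ∣ (λ r → add2 varN (const2 (sqDiff d r)))))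

summand-integral : ∀ d k → k ≤ ∣ d ∣ → Integral₂ (summand d k)
summand-integral d k k≤e = multiples₂-trans (fcoefScalar*prodℚ-integer d k k≤e)
  (mul2-multiples
    (mul2-multiples-integral (const2-multiples multiple-refl)
      (mul2-integral (fallingJ-integral k) (doubleRisingJ-integral k)))
    (mul2-multiples-integral (const2-multiples multiple-refl)
      (prod2-integral (∣ d ∣ ∸ k) _ (λ r →
        add2-multiples varN-integral (const2-multiples (integer (d ℤ.* d ℤ.- + ((k + r) * (k + r)))))))))

proposition5p1 : (d : ℤ) (a b : ℕ) → ∃ λ (z : ℤ) → coeff (G d) a b ≡ ℤ→ℚ z
proposition5p1 d a b with coeff-multiple (sum2-integral ∣ d ∣ (summand d) (summand-integral d)) a b
... | z , eq = z , trans eq (ℚP.*-identityˡ (ℤ→ℚ z))
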